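{- Let $G=(U,W,E)$ be a convex bipartite graph with $|U|\ge 2$ and $|W|\ge 2$, with convex ordering $w_1,\dots,w_{|W|}$ of $W$, and let $D$ be a minimal connected dominating set of $G$. Let $i,j\in D\cap U$ with $I_i\cap I_j\neq\emptyset$. Then $|\{k\in (D\cap U)\setminus\{i,j\} : I_k\subsetneq I_i\cup I_j\}|\le 1$.
   Context: All graphs are finite, undirected, simple. A bipartite graph $G=(U,W,E)$ is convex if there is an ordering $w_1,\dots,w_{|W|}$ of $W$ such that for every $u\in U$ the neighborhood $N(u)\subseteq W$ is a set of consecutive vertices $I_u$ in this ordering (the neighbor interval of $u$, viewed as a subset of $W$). A set $D\subseteq V(G)$ is a connected dominating set if $G[D]$ is connected and every vertex of $G$ is in $D$ or has a neighbor in $D$; it is minimal if no proper subset of it is a connected dominating set. -}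

module Defs where

open import Data.Nat using (ℕ)
open import Data.Fin using (Fin; _≤_)
open import Data.Bool using (Bool; true; false; _∨_)
open import Data.Sum using (_⊎_; inj₁; inj₂)
open import Data.Product using (_×_; ∃-syntax)
open import Data.Empty using (⊥)
open import Relation.Nullary using (¬_)
open import Relation.Binary.PropositionalEquality using (_≡_)

-- A bipartite graph G = (U, W, E) with U = Fin m, W = Fin n, given by its
-- biadjacency relation (decidable, as a Bool).  Vertices of G are U ⊎ W.
BiAdj : ℕ → ℕ → Set
BiAdj m n = Fin m → Fin n → Bool

Vertex : ℕ → ℕ → Set
Vertex m n = Fin m ⊎ Fin n

Edge : ∀ {m n} → BiAdj m n → Vertex m n → Vertex m n → Set
Edge A (inj₁ u) (inj₁ u′) = ⊥
Edge A (inj₁ u) (inj₂ w)  = A u w ≡ true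
Edge A (inj₂ w) (inj₁ u)  = A u w ≡ true
Edge A (inj₂ w) (inj₂ w′) = ⊥

-- Convexity w.r.t. the ordering w₁,…,w_|W| given by the index order of Fin n:
-- every neighbourhood N(u) is a set of consecutive vertices.
IsConvex : ∀ {m n} → BiAdj m n → Set
IsConvex {m} {n} A =
  ∀ (u : Fin m) (a b c : Fin n) → a ≤ b → b ≤ c →
    A u a ≡ true → A u c ≡ true → A u b ≡ true

VSet : ℕ → ℕ → Set
VSet m n = Vertex m n → Bool

_⊆_ : ∀ {m n} → VSet m n → VSet m n → Set
D′ ⊆ D = ∀ x → D′ x ≡ true → D x ≡ true

data WalkIn {m n} (A : BiAdj m n) (D : VSet m n) : Vertex m n → Vertex m n → Set where
  here : ∀ {x} → D x ≡ true → WalkIn A D x x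
  step : ∀ {x y z} → D x ≡ true → Edge A x y → WalkIn A D y z → WalkIn A D x z

Connected : ∀ {m n} → BiAdj m n → VSet m n → Set
Connected {m} {n} A D =
  (∃[ x ] D x ≡ true) ×
  (∀ x y → D x ≡ true → D y ≡ true → WalkIn A D x y)

Dominating : ∀ {m n} → BiAdj m n → VSet m n → Set
Dominating {m} {n} A D =
  ∀ (x : Vertex m n) → D x ≡ true ⊎ (∃[ y ] (Edge A x y × D y ≡ true))

IsCDS : ∀ {m n} → BiAdj m n → VSet m n → Set
IsCDS A D = Connected A D × Dominating A D

-- Minimal: no proper subset is a CDS, i.e. every CDS contained in D equals D.
IsMinimalCDS : ∀ {m n} → BiAdj m n → VSet m n → Set
IsMinimalCDS A D = IsCDS A D × (∀ D′ → D′ ⊆ D → IsCDS A D′ → D ⊆ D′)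

I : ∀ {m n} → BiAdj m n → Fin m → Fin n → Bool
I A u w = A u w

StrictSubUnion : ∀ {m n} → BiAdj m n → Fin m → Fin m → Fin m → Set
StrictSubUnion {m} {n} A k i j =
  (∀ (w : Fin n) → I A k w ≡ true → (I A i w ∨ I A j w) ≡ true) ×
  ¬ (∀ (w : Fin n) → (I A i w ∨ I A j w) ≡ true → I A k w ≡ true)

InS : ∀ {m n} → BiAdj m n → VSet m n → Fin m → Fin m → Fin m → Set
InS A D i j k = D (inj₁ k) ≡ true × ¬ k ≡ i × ¬ k ≡ j × StrictSubUnion A k i j

module Submission where

-- If N(k) ⊆ N(i) ∪ N(j) for some k ∈ D ∖ {i, j}, then D ∖ {k} is still
-- dominating, and it is connected as soon as every D-neighbour of k is joined
-- to i inside D ∖ {k}; by minimality this must fail.  For a second such vertex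
-- k′, both N(k′) ∩ N(i) ∩ D and N(k′) ∩ N(j) ∩ D are nonempty (otherwise every
-- D-neighbour of k′ lies next to one and the same vertex among i, j, and k′
-- could be deleted), so i – x – k′ – y – j joins i and j avoiding k, and then
-- every D-neighbour of k reaches i through i or j.

open import Defs
open import Data.Nat using (ℕ; _≤_)
open import Data.Fin using (Fin; _≟_)
open import Data.Fin.Properties using (any?)
open import Data.Bool using (true; false; _∨_)
import Data.Bool.Properties as Bool
open import Data.Sum using (_⊎_; inj₁; inj₂)
open import Data.Product using (_×_; _,_; ∃-syntax; proj₁)
open import Data.Empty using (⊥; ⊥-elim)
open import Relation.Nullary using (¬_; yes; no; Dec)
open import Relation.Nullary.Decidable using (_×-dec_)
open import Relation.Binary.PropositionalEquality
  using (_≡_; _≢_; refl; sym; trans; ≢-sym)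

∨-true : ∀ x y → (x ∨ y) ≡ true → x ≡ true ⊎ y ≡ true
∨-true true  _ _   = inj₁ refl
∨-true false _ y≡t = inj₂ y≡t

CoveredBy : ∀ {m n} → BiAdj m n → Fin m → Fin m → Fin m → Set
CoveredBy {n = n} A k a b = ∀ (w : Fin n) → A k w ≡ true → (A a w ∨ A b w) ≡ true

CoveredBy-swap : ∀ {m n} {A : BiAdj m n} {k a b} → CoveredBy A k a b → CoveredBy A k b a
CoveredBy-swap {A = A} {a = a} {b} cov w kw = trans (Bool.∨-comm (A b w) (A a w)) (cov w kw)

module _ {m n : ℕ} where

  _∖_ : VSet m n → Fin m → VSet m n
  (D ∖ k) (inj₁ u) with u ≟ k
  ... | yes _ = false
  ... | no  _ = D (inj₁ u)
  (D ∖ k) (inj₂ w) = D (inj₂ w)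

  module _ {D : VSet m n} {k : Fin m} where

    ∖-self : (D ∖ k) (inj₁ k) ≡ false
    ∖-self with k ≟ k
    ... | yes _  = refl
    ... | no k≢k = ⊥-elim (k≢k refl)

    ∖-⊆ : (D ∖ k) ⊆ D
    ∖-⊆ (inj₁ u) d with u ≟ k
    ∖-⊆ (inj₁ u) () | yes _
    ... | no _ = d
    ∖-⊆ (inj₂ w) d = d

    ∖-keep : ∀ {u} → D (inj₁ u) ≡ true → k ≢ u → (D ∖ k) (inj₁ u) ≡ true
    ∖-keep {u} du k≢u with u ≟ k
    ... | yes u≡k = ⊥-elim (k≢u (sym u≡k))
    ... | no  _   = du

module _ {m n : ℕ} {A : BiAdj m n} where

  Edge-sym : ∀ {x y} → Edge A x y → Edge A y x
  Edge-sym {inj₁ _} {inj₂ _} e = e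
  Edge-sym {inj₂ _} {inj₁ _} e = e

  module _ {D : VSet m n} where

    walk-start : ∀ {x y} → WalkIn A D x y → D x ≡ true
    walk-start (here dx)     = dx
    walk-start (step dx _ _) = dx

    _++ʷ_ : ∀ {x y z} → WalkIn A D x y → WalkIn A D y z → WalkIn A D x z
    here _      ++ʷ q = q
    step dx e p ++ʷ q = step dx e (p ++ʷ q)

    walk-reverse : ∀ {x y} → WalkIn A D x y → WalkIn A D y x
    walk-reverse (here dx)     = here dx
    walk-reverse (step dx e p) =
      walk-reverse p ++ʷ step (walk-start p) (Edge-sym e) (here dx)

  module _ {D : VSet m n} {k : Fin m} where

    -- A walk of G[D] to h passes through k only as w – k – w′ with w a
    -- D-neighbour of k, so it can be cut at w and continued by hub w.
    module Rerouting (h : Vertex m n) (dh : (D ∖ k) h ≡ true)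
      (hub : ∀ w → D (inj₂ w) ≡ true → A k w ≡ true → WalkIn A (D ∖ k) (inj₂ w) h) where

      reroute : ∀ {x} → WalkIn A D x h → (D ∖ k) x ≡ true → WalkIn A (D ∖ k) x h
      reroute (here _) dx = here dx
      reroute (step {inj₁ _} {inj₂ _} _ e p) dx = step dx e (reroute p (walk-start p))
      reroute (step {inj₂ w} {inj₁ u} dw e p) dx with u ≟ k
      ... | yes refl = hub w dw e
      ... | no  u≢k  = step dx e (reroute p (∖-keep (walk-start p) (≢-sym u≢k)))

      ∖-connected : Connected A D → Connected A (D ∖ k)
      ∖-connected (_ , walk) = (h , dh) , λ x y dx dy →
        to-h x dx ++ʷ walk-reverse (to-h y dy)
        where
        to-h : ∀ x → (D ∖ k) x ≡ true → WalkIn A (D ∖ k) x h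
        to-h x dx = reroute (walk x h (∖-⊆ x dx) (∖-⊆ h dh)) dx

    first-step-off-k : ∀ {y} → WalkIn A D (inj₁ k) y → (D ∖ k) y ≡ true →
      ∃[ z ] (Edge A (inj₁ k) z × (D ∖ k) z ≡ true)
    first-step-off-k (here _) dy with trans (sym dy) (∖-self {D = D} {k})
    ... | ()
    first-step-off-k (step {y = inj₂ w} _ e p) _ = inj₂ w , e , walk-start p

    ∖-dominating : IsCDS A D → D (inj₁ k) ≡ true →
      ∀ h → (D ∖ k) h ≡ true →
      (∀ w → A k w ≡ true → ∃[ u ] ((D ∖ k) (inj₁ u) ≡ true × A u w ≡ true)) →
      Dominating A (D ∖ k)
    ∖-dominating ((_ , walk) , dom) dk h dh cover (inj₁ u) with u ≟ k | dom (inj₁ u)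
    ... | yes refl | _ = inj₂ (first-step-off-k (walk (inj₁ k) h dk (∖-⊆ h dh)) dh)
    ... | no  _    | inj₁ du = inj₁ du
    ... | no  _    | inj₂ (inj₂ w , e , dw) = inj₂ (inj₂ w , e , dw)
    ∖-dominating ((_ , _) , dom) _ _ _ cover (inj₂ w) with dom (inj₂ w)
    ... | inj₁ dw = inj₁ dw
    ... | inj₂ (inj₁ u , e , du) with u ≟ k
    ...   | no  u≢k  = inj₂ (inj₁ u , e , ∖-keep du (≢-sym u≢k))
    ...   | yes refl with cover w e
    ...     | u′ , du′ , e′ = inj₂ (inj₁ u′ , e′ , du′)

    minimal⇒¬CDS-∖ : IsMinimalCDS A D → D (inj₁ k) ≡ true → ¬ IsCDS A (D ∖ k)
    minimal⇒¬CDS-∖ (_ , minimal) dk cds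
      with trans (sym (minimal (D ∖ k) ∖-⊆ cds (inj₁ k) dk)) (∖-self {D = D} {k})
    ... | ()

    module _ (minimal : IsMinimalCDS A D) (dk : D (inj₁ k) ≡ true) (a b : Fin m)
      (da : (D ∖ k) (inj₁ a) ≡ true) (db : (D ∖ k) (inj₁ b) ≡ true)
      (cov : CoveredBy A k a b) where

      hub⇒¬minimal :
        (∀ w → D (inj₂ w) ≡ true → A k w ≡ true → WalkIn A (D ∖ k) (inj₂ w) (inj₁ a)) → ⊥
      hub⇒¬minimal hub = minimal⇒¬CDS-∖ minimal dk
        (∖-connected (proj₁ cds) , ∖-dominating cds dk (inj₁ a) da cover)
        where
        open Rerouting (inj₁ a) da hub
        cds : IsCDS A D
        cds = proj₁ minimal
        cover : ∀ w → A k w ≡ true → ∃[ u ] ((D ∖ k) (inj₁ u) ≡ true × A u w ≡ true)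
        cover w kw with ∨-true (A a w) (A b w) (cov w kw)
        ... | inj₁ aw = a , da , aw
        ... | inj₂ bw = b , db , bw

      bridged⇒¬minimal : WalkIn A (D ∖ k) (inj₁ a) (inj₁ b) → ⊥
      bridged⇒¬minimal a⇝b = hub⇒¬minimal λ w dw kw → case w dw (cov w kw)
        where
        case : ∀ w → D (inj₂ w) ≡ true → (A a w ∨ A b w) ≡ true → WalkIn A (D ∖ k) (inj₂ w) (inj₁ a)
        case w dw aw∨bw with ∨-true (A a w) (A b w) aw∨bw
        ... | inj₁ aw = step dw aw (here da)
        ... | inj₂ bw = step dw bw (walk-reverse a⇝b)

    shared-neighbour : IsMinimalCDS A D → D (inj₁ k) ≡ true → ∀ {a b} →
      (D ∖ k) (inj₁ a) ≡ true → (D ∖ k) (inj₁ b) ≡ true → CoveredBy A k a b →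
      ∃[ w ] (D (inj₂ w) ≡ true × A k w ≡ true × A a w ≡ true)
    shared-neighbour minimal dk {a} {b} da db cov with any? shared?
      where
      shared? : ∀ w → Dec (D (inj₂ w) ≡ true × A k w ≡ true × A a w ≡ true)
      shared? w = (D (inj₂ w) Bool.≟ true) ×-dec (A k w Bool.≟ true) ×-dec (A a w Bool.≟ true)
    ... | yes shared = shared
    ... | no ¬shared = ⊥-elim (hub⇒¬minimal minimal dk b a db da (CoveredBy-swap {A = A} cov) to-b)
      where
      to-b : ∀ w → D (inj₂ w) ≡ true → A k w ≡ true → WalkIn A (D ∖ k) (inj₂ w) (inj₁ b)
      to-b w dw kw with ∨-true (A a w) (A b w) (cov w kw)
      ... | inj₁ aw = ⊥-elim (¬shared (w , dw , kw , aw))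
      ... | inj₂ bw = step dw bw (here db)

mainTheorem7 : (m n : ℕ) → 2 ≤ m → 2 ≤ n → (A : BiAdj m n) → IsConvex A →
    (D : VSet m n) → IsMinimalCDS A D →
    (i j : Fin m) → D (inj₁ i) ≡ true → D (inj₁ j) ≡ true →
    (∃[ w ] (I A i w ≡ true × I A j w ≡ true)) →
    (k k′ : Fin m) → InS A D i j k → InS A D i j k′ → k ≡ k′
mainTheorem7 m _ _ _ A _ D minimal i j di dj _ k k′
  (dk , k≢i , k≢j , (covk , _)) (dk′ , k′≢i , k′≢j , (covk′ , _)) with k ≟ k′
... | yes k≡k′ = k≡k′
... | no  k≢k′ = ⊥-elim (bridged⇒¬minimal minimal dk i j (∖-keep di k≢i) (∖-keep dj k≢j) covk i⇝j)
  where
  SharedWith : Fin m → Set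
  SharedWith u = ∃[ w ] (D (inj₂ w) ≡ true × A k′ w ≡ true × A u w ≡ true)

  shared-i : SharedWith i
  shared-i = shared-neighbour minimal dk′ (∖-keep di k′≢i) (∖-keep dj k′≢j) covk′

  shared-j : SharedWith j
  shared-j = shared-neighbour minimal dk′ (∖-keep dj k′≢j) (∖-keep di k′≢i) (CoveredBy-swap {A = A} covk′)

  i⇝j : WalkIn A (D ∖ k) (inj₁ i) (inj₁ j)
  i⇝j with shared-i | shared-j
  ... | x , dx , k′x , ix | y , dy , k′y , jy =
    step {y = inj₂ x} (∖-keep di k≢i) ix (step {y = inj₁ k′} dx k′x
      (step {y = inj₂ y} (∖-keep dk′ k≢k′) k′y (step dy jy (here (∖-keep dj k≢j)))))
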